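{- Let $G_1,G_2$ be disjoint copies of $C_3$ and $f:V(G_1)\to V(G_2)$ a function. Then $\gamma(C(C_3,f))=2\gamma(C_3)$ if and only if $f$ is not a constant function.
   Context: For disjoint copies $G_1,G_2$ of a graph $G$ and a function $f:V(G_1)\to V(G_2)$, the functigraph $C(G,f)$ has vertex set $V(G_1)\cup V(G_2)$ and edge set $E(G_1)\cup E(G_2)\cup\{uv : u\in V(G_1), v\in V(G_2), v=f(u)\}$. $\gamma$ denotes domination number. -}

module Defs where

open import Data.Nat using (ℕ; _≤_; _*_; _+_)
open import Data.Fin using (Fin; splitAt)
open import Data.Fin.Subset using (Subset; _∈_; ∣_∣)
open import Data.Sum using (_⊎_; inj₁; inj₂)
open import Data.Empty using (⊥)
open import Data.Product using (_×_; ∃-syntax; _,_)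
open import Relation.Binary.PropositionalEquality using (_≡_; _≢_; refl; sym)
open import Relation.Nullary using (¬_)

record Graph (n : ℕ) : Set₁ where
  field
    Adj     : Fin n → Fin n → Set
    Adj-sym : ∀ {u v} → Adj u v → Adj v u
    irrefl  : ∀ {u} → ¬ Adj u u
open Graph public

Dominating : ∀ {n} → Graph n → Subset n → Set
Dominating {n} G D = ∀ (v : Fin n) → v ∈ D ⊎ ∃[ u ] (u ∈ D × Adj G v u)

IsDominationNumber : ∀ {n} → Graph n → ℕ → Set
IsDominationNumber {n} G k =
  (∃[ D ] (Dominating G D × ∣ D ∣ ≡ k)) × (∀ (D : Subset n) → Dominating G D → k ≤ ∣ D ∣)

-- Functigraph adjacency on the disjoint union Fin n ⊎ Fin n
-- (inj₁ = copy G₁, inj₂ = copy G₂): edges of G₁, edges of G₂, and u ~ f u.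
FAdj : ∀ {n} → Graph n → (Fin n → Fin n) → Fin n ⊎ Fin n → Fin n ⊎ Fin n → Set
FAdj G f (inj₁ u) (inj₁ v) = Adj G u v
FAdj G f (inj₂ u) (inj₂ v) = Adj G u v
FAdj G f (inj₁ u) (inj₂ v) = v ≡ f u
FAdj G f (inj₂ v) (inj₁ u) = v ≡ f u

FAdj-sym : ∀ {n} (G : Graph n) f {x y} → FAdj G f x y → FAdj G f y x
FAdj-sym G f {inj₁ u} {inj₁ v} p = Adj-sym G p
FAdj-sym G f {inj₂ u} {inj₂ v} p = Adj-sym G p
FAdj-sym G f {inj₁ u} {inj₂ v} p = p
FAdj-sym G f {inj₂ v} {inj₁ u} p = p

FAdj-irrefl : ∀ {n} (G : Graph n) f {x} → ¬ FAdj G f x x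
FAdj-irrefl G f {inj₁ u} = irrefl G
FAdj-irrefl G f {inj₂ u} = irrefl G

Functigraph : ∀ {n} → Graph n → (Fin n → Fin n) → Graph (n + n)
Functigraph {n} G f = record
  { Adj     = λ x y → FAdj G f (splitAt n x) (splitAt n y)
  ; Adj-sym = λ {x} {y} → FAdj-sym G f {splitAt n x} {splitAt n y}
  ; irrefl  = λ {x} → FAdj-irrefl G f {splitAt n x}
  }

-- The cycle C₃ on Fin 3 (= K₃): distinct vertices are adjacent.
C3 : Graph 3
C3 = record
  { Adj     = λ u v → u ≢ v
  ; Adj-sym = λ p q → p (sym q)
  ; irrefl  = λ p → p refl
  }

Constant : ∀ {n} → (Fin n → Fin n) → Set
Constant {n} f = ∀ (u v : Fin n) → f u ≡ f v

-- A vertex of copy G₁ has exactly one neighbour f u in copy G₂, and a vertex y of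
-- G₂ is adjacent to u in G₁ only when f u = y; so a single vertex dominates the
-- functigraph C(G,f) only if f is constant. Conversely, if G has a universal
-- vertex c with copies c₁ ∈ G₁, c₂ ∈ G₂, then {c₂} dominates C(G,f) when f is
-- constantly c, and {c₁, c₂} always does. As every vertex of C₃ is universal,
-- γ(C₃) = 1 and γ(C(C₃,f)) is 1 or 2 according as f is constant or not.
module Submission where

open import Defs
open import Data.Nat using (ℕ; _+_; _*_; _≤_; _<_)
open import Data.Nat.Properties using (≤-antisym)
open import Data.Fin using (Fin; zero; splitAt; join; _↑ˡ_; _↑ʳ_; _≟_)
open import Data.Fin.Properties using (splitAt-↑ˡ; splitAt-↑ʳ; splitAt-join; join-splitAt)
open import Data.Fin.Subset using (Subset; _∈_; _⊆_; ∣_∣; ⁅_⁆; _∪_; Nonempty)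
open import Data.Fin.Subset.Properties
  using (∉⊥; ⊥⊆; ∣⊥∣≡0; x∈⁅x⁆; x∈⁅y⁆⇒x≡y; x≢y⇒x∉⁅y⁆; ∣⁅x⁆∣≡1; _⊂?_; p⊂q⇒∣p∣<∣q∣; x∈p∪q⁺)
open import Data.Sum using (_⊎_; inj₁; inj₂; map₁)
open import Data.Product using (_×_; _,_; ∃-syntax)
open import Data.Empty using (⊥-elim)
open import Relation.Binary.PropositionalEquality using (_≡_; refl; sym; trans; subst; cong; module ≡-Reasoning)
open import Relation.Nullary using (¬_; yes; no)

ClosedAdj : {A : Set} → (A → A → Set) → A → A → Set
ClosedAdj R v x = v ≡ x ⊎ R v x

Universal : {A : Set} → (A → A → Set) → A → Set
Universal R x = ∀ v → ClosedAdj R v x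

nonempty⇒1≤∣p∣ : ∀ {n} {p : Subset n} → Nonempty p → 1 ≤ ∣ p ∣
nonempty⇒1≤∣p∣ {n} {p} (x , x∈p) =
  subst (_< ∣ p ∣) (∣⊥∣≡0 n) (p⊂q⇒∣p∣<∣q∣ (⊥⊆ , x , x∈p , ∉⊥))

x∈p⇒p⊆⁅x⁆⊎2≤∣p∣ : ∀ {n} {x : Fin n} {p : Subset n} → x ∈ p → p ⊆ ⁅ x ⁆ ⊎ 2 ≤ ∣ p ∣
x∈p⇒p⊆⁅x⁆⊎2≤∣p∣ {x = x} {p} x∈p with ⁅ x ⁆ ⊂? p
... | yes ⁅x⁆⊂p = inj₂ (subst (_< ∣ p ∣) (∣⁅x⁆∣≡1 x) (p⊂q⇒∣p∣<∣q∣ ⁅x⁆⊂p))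
... | no ⁅x⁆⊄p = inj₁ p⊆⁅x⁆
  where
  ⁅x⁆⊆p : ⁅ x ⁆ ⊆ p
  ⁅x⁆⊆p y∈⁅x⁆ = subst (_∈ p) (sym (x∈⁅y⁆⇒x≡y x y∈⁅x⁆)) x∈p

  p⊆⁅x⁆ : p ⊆ ⁅ x ⁆
  p⊆⁅x⁆ {y} y∈p with y ≟ x
  ... | yes refl = x∈⁅x⁆ x
  ... | no y≢x = ⊥-elim (⁅x⁆⊄p (⁅x⁆⊆p , y , y∈p , x≢y⇒x∉⁅y⁆ y≢x))

module _ {n} (G : Graph n) where

  dominating-via-closedAdj : ∀ {D} → (∀ v → ∃[ x ] (x ∈ D × ClosedAdj (Adj G) v x)) →
                             Dominating G D
  dominating-via-closedAdj near v with near v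
  ... | x , x∈D , inj₁ refl = inj₁ x∈D
  ... | x , x∈D , inj₂ adj  = inj₂ (x , x∈D , adj)

  dominating-mono : ∀ {D D′} → D ⊆ D′ → Dominating G D → Dominating G D′
  dominating-mono D⊆D′ d v with d v
  ... | inj₁ v∈D             = inj₁ (D⊆D′ v∈D)
  ... | inj₂ (u , u∈D , adj) = inj₂ (u , D⊆D′ u∈D , adj)

  dominating⇒nonempty : ∀ {D} → Fin n → Dominating G D → Nonempty D
  dominating⇒nonempty v d with d v
  ... | inj₁ v∈D           = v , v∈D
  ... | inj₂ (u , u∈D , _) = u , u∈D

  universal⇒dominating-⁅x⁆ : ∀ {x} → Universal (Adj G) x → Dominating G ⁅ x ⁆
  universal⇒dominating-⁅x⁆ {x} u = dominating-via-closedAdj (λ v → x , x∈⁅x⁆ x , u v)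

  dominating-⁅x⁆⇒universal : ∀ {x} → Dominating G ⁅ x ⁆ → Universal (Adj G) x
  dominating-⁅x⁆⇒universal {x} d v with d v
  ... | inj₁ v∈⁅x⁆ = inj₁ (x∈⁅y⁆⇒x≡y x v∈⁅x⁆)
  ... | inj₂ (u , u∈⁅x⁆ , adj) rewrite x∈⁅y⁆⇒x≡y x u∈⁅x⁆ = inj₂ adj

  no-universal⇒2≤∣dominating∣ : ∀ {D} → Fin n → (∀ x → ¬ Universal (Adj G) x) →
                                 Dominating G D → 2 ≤ ∣ D ∣
  no-universal⇒2≤∣dominating∣ v ¬universal d with dominating⇒nonempty v d
  ... | x , x∈D with x∈p⇒p⊆⁅x⁆⊎2≤∣p∣ x∈D
  ...   | inj₁ D⊆⁅x⁆ =
    ⊥-elim (¬universal x (dominating-⁅x⁆⇒universal (dominating-mono D⊆⁅x⁆ d)))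
  ...   | inj₂ 2≤∣D∣ = 2≤∣D∣

  domination-number-unique : ∀ {k m} → IsDominationNumber G k → IsDominationNumber G m → k ≡ m
  domination-number-unique ((D , dD , refl) , minimalK) ((E , dE , refl) , minimalM) =
    ≤-antisym (minimalK E dE) (minimalM D dD)

  universal⇒γ≡1 : ∀ {x} → Universal (Adj G) x → IsDominationNumber G 1
  universal⇒γ≡1 {x} u =
    (⁅ x ⁆ , universal⇒dominating-⁅x⁆ u , ∣⁅x⁆∣≡1 x) ,
    λ D d → nonempty⇒1≤∣p∣ (dominating⇒nonempty x d)

  no-universal⇒γ≡2 : ∀ {D} → Fin n → (∀ x → ¬ Universal (Adj G) x) →
                      Dominating G D → ∣ D ∣ ≡ 2 → IsDominationNumber G 2
  no-universal⇒γ≡2 {D} v ¬universal d ∣D∣≡2 =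
    (D , d , ∣D∣≡2) , λ E e → no-universal⇒2≤∣dominating∣ v ¬universal e

splitAt-injective : ∀ m {n} {i j : Fin (m + n)} → splitAt m i ≡ splitAt m j → i ≡ j
splitAt-injective m {n} {i} {j} eq = begin
  i                      ≡⟨ sym (join-splitAt m n i) ⟩
  join m n (splitAt m i) ≡⟨ cong (join m n) eq ⟩
  join m n (splitAt m j) ≡⟨ join-splitAt m n j ⟩
  j                      ∎
  where open ≡-Reasoning

module _ {n} (G : Graph n) (f : Fin n → Fin n) where

  private
    F : Graph (n + n)
    F = Functigraph G f

  closedAdj-splitAt⁺ : ∀ {v x} → ClosedAdj (Adj F) v x →
                       ClosedAdj (FAdj G f) (splitAt n v) (splitAt n x)
  closedAdj-splitAt⁺ (inj₁ refl) = inj₁ refl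
  closedAdj-splitAt⁺ (inj₂ adj)  = inj₂ adj

  closedAdj-splitAt⁻ : ∀ {v x s} → splitAt n x ≡ s →
                       ClosedAdj (FAdj G f) (splitAt n v) s → ClosedAdj (Adj F) v x
  closedAdj-splitAt⁻ refl (inj₁ eq)  = inj₁ (splitAt-injective n eq)
  closedAdj-splitAt⁻ refl (inj₂ adj) = inj₂ adj

  universal-splitAt⁺ : ∀ {x} → Universal (Adj F) x → Universal (FAdj G f) (splitAt n x)
  universal-splitAt⁺ {x} u t =
    subst (λ s → ClosedAdj (FAdj G f) s (splitAt n x)) (splitAt-join n n t)
          (closedAdj-splitAt⁺ (u (join n n t)))

  universal-splitAt⁻ : ∀ {x s} → splitAt n x ≡ s → Universal (FAdj G f) s → Universal (Adj F) x
  universal-splitAt⁻ eq u v = closedAdj-splitAt⁻ eq (u (splitAt n v))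

  FAdj-universal⇒constant : ∀ s → Universal (FAdj G f) s → Constant f
  FAdj-universal⇒constant (inj₁ w) u a b = trans (image≡fw (f a)) (sym (image≡fw (f b)))
    where
    image≡fw : ∀ y → y ≡ f w
    image≡fw y with u (inj₂ y)
    ... | inj₁ ()
    ... | inj₂ y≡fw = y≡fw
  FAdj-universal⇒constant (inj₂ y) u a b = trans (sym (y≡f a)) (y≡f b)
    where
    y≡f : ∀ a → y ≡ f a
    y≡f a with u (inj₁ a)
    ... | inj₁ ()
    ... | inj₂ y≡fa = y≡fa

  constant⇒FAdj-universal : ∀ {c} → Universal (Adj G) c → (∀ u → f u ≡ c) →
                            Universal (FAdj G f) (inj₂ c)
  constant⇒FAdj-universal uc fu≡c (inj₁ u) = inj₂ (sym (fu≡c u))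
  constant⇒FAdj-universal uc fu≡c (inj₂ v) = map₁ (cong inj₂) (uc v)

  FAdj-pair-dominating : ∀ {c} → Universal (Adj G) c →
                         ∀ t → ClosedAdj (FAdj G f) t (inj₁ c) ⊎ ClosedAdj (FAdj G f) t (inj₂ c)
  FAdj-pair-dominating uc (inj₁ u) = inj₁ (map₁ (cong inj₁) (uc u))
  FAdj-pair-dominating uc (inj₂ v) = inj₂ (map₁ (cong inj₂) (uc v))

  functigraph-universal⇒constant : ∀ {x} → Universal (Adj F) x → Constant f
  functigraph-universal⇒constant {x} u =
    FAdj-universal⇒constant (splitAt n x) (universal-splitAt⁺ u)

  constant⇒functigraph-universal : ∀ {c} → Universal (Adj G) c → (∀ u → f u ≡ c) →
                                   Universal (Adj F) (n ↑ʳ c)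
  constant⇒functigraph-universal {c} uc fu≡c =
    universal-splitAt⁻ (splitAt-↑ʳ n n c) (constant⇒FAdj-universal uc fu≡c)

  functigraph-pair-dominating : ∀ {c} → Universal (Adj G) c →
                                Dominating F (⁅ c ↑ˡ n ⁆ ∪ ⁅ n ↑ʳ c ⁆)
  functigraph-pair-dominating {c} uc = dominating-via-closedAdj F near
    where
    near : ∀ v → ∃[ x ] (x ∈ ⁅ c ↑ˡ n ⁆ ∪ ⁅ n ↑ʳ c ⁆ × ClosedAdj (Adj F) v x)
    near v with FAdj-pair-dominating uc (splitAt n v)
    ... | inj₁ near₁ =
      c ↑ˡ n , x∈p∪q⁺ (inj₁ (x∈⁅x⁆ (c ↑ˡ n))) , closedAdj-splitAt⁻ (splitAt-↑ˡ n c n) near₁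
    ... | inj₂ near₂ =
      n ↑ʳ c , x∈p∪q⁺ (inj₂ (x∈⁅x⁆ (n ↑ʳ c))) , closedAdj-splitAt⁻ (splitAt-↑ʳ n n c) near₂

C3-universal : ∀ c → Universal (Adj C3) c
C3-universal c v with v ≟ c
... | yes v≡c = inj₁ v≡c
... | no v≢c  = inj₂ v≢c

γ-C3 : IsDominationNumber C3 1
γ-C3 = universal⇒γ≡1 C3 (C3-universal zero)

module _ (f : Fin 3 → Fin 3) where

  γ-functigraph-C3-constant : Constant f → IsDominationNumber (Functigraph C3 f) 1
  γ-functigraph-C3-constant constant =
    universal⇒γ≡1 (Functigraph C3 f)
      (constant⇒functigraph-universal C3 f (C3-universal (f zero)) (λ u → constant u zero))

  γ-functigraph-C3-nonconstant : ¬ Constant f → IsDominationNumber (Functigraph C3 f) 2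
  γ-functigraph-C3-nonconstant nonconstant =
    no-universal⇒γ≡2 (Functigraph C3 f) zero
      (λ x u → nonconstant (functigraph-universal⇒constant C3 f u))
      (functigraph-pair-dominating C3 f (C3-universal zero)) refl

lemma3p3 : (f : Fin 3 → Fin 3) (γF γC : ℕ) →
    IsDominationNumber (Functigraph C3 f) γF → IsDominationNumber C3 γC →
    ((γF ≡ 2 * γC → ¬ Constant f) × (¬ Constant f → γF ≡ 2 * γC))
lemma3p3 f γF γC γF-spec γC-spec rewrite domination-number-unique C3 γC-spec γ-C3 =
  γF≡2⇒nonconstant , nonconstant⇒γF≡2
  where
  γF-unique : ∀ {k} → IsDominationNumber (Functigraph C3 f) k → γF ≡ k
  γF-unique = domination-number-unique (Functigraph C3 f) γF-spec

  γF≡2⇒nonconstant : γF ≡ 2 → ¬ Constant f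
  γF≡2⇒nonconstant γF≡2 constant with trans (sym (γF-unique (γ-functigraph-C3-constant f constant))) γF≡2
  ... | ()

  nonconstant⇒γF≡2 : ¬ Constant f → γF ≡ 2
  nonconstant⇒γF≡2 nonconstant = γF-unique (γ-functigraph-C3-nonconstant f nonconstant)
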